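{- Let $\Gamma=K_n\Box K_m$, $G=\langle c\rangle$ with $c(a,b)=(a+1,b)$, and let $P=P(v_0,\overrightarrow{a})$ be an $\ell$-path in $\Gamma$, where $\overrightarrow{a}=[a_1,\dots,a_\ell]$. For $0\leqslant i<j<\ell$ consider the conditions (a) $\left(\sum_{g=i+1}^{j}a_g\right)_2\neq 0$ or $a_{i+1}\neq a_{j+1}$; (b) $\left(\sum_{g=i+1}^{j+1}a_g\right)_2\neq 0$ or $a_{i+1}\neq -a_{j+1}$. Then $P$ contains at most one edge from each $G$-orbit on $E(\Gamma)$ if and only if (a) and (b) hold for all $i,j\in\{0,1,\dots,\ell-1\}$ with $i<j$.
   Context: $K_n \Box K_m$ has vertex set $\mathbb{Z}_n\times\mathbb{Z}_m$, with $(a,b)$ and $(c,d)$ adjacent iff they are distinct and $a=c$ or $b=d$. Given $v_0$ and an array $\overrightarrow{a}=[a_1,\dots,a_\ell]$ with each $a_i$ of the form $(c,0)$, $c\in\mathbb{Z}_n\setminus\{0\}$, or $(0,c')$, $c'\in\mathbb{Z}_m\setminus\{0\}$, $P(v_0,\overrightarrow{a})$ is the walk $v_0v_1\cdots v_\ell$ with $v_i=v_0+\sum_{g=1}^i a_g$, assumed here to be a path (all $v_i$ distinct); its edges are $\{v_{i-1},v_i\}$. For $x=(x_1,x_2)\in\mathbb{Z}_n\times\mathbb{Z}_m$, $(x)_2=x_2$. -}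

module Defs where

open import Data.Nat using (ℕ; zero; suc; _∸_; NonZero)
import Data.Nat as N
open import Data.Nat.DivMod using (_%_; m%n<n)
open import Data.Fin using (Fin; toℕ; fromℕ<)
open import Data.Product using (_×_; _,_; proj₁; proj₂; ∃)
open import Data.Sum using (_⊎_)
open import Relation.Binary.PropositionalEquality using (_≡_; _≢_)

-- ℤ_n represented as Fin n, with arithmetic mod n
module _ {n : ℕ} {{_ : NonZero n}} where
  _+ₙ_ : Fin n → Fin n → Fin n
  x +ₙ y = fromℕ< (m%n<n (toℕ x N.+ toℕ y) n)

  -ₙ_ : Fin n → Fin n
  -ₙ x = fromℕ< (m%n<n (n ∸ toℕ x) n)

  0ₙ : Fin n
  0ₙ = fromℕ< (m%n<n 0 n)

  1ₙ : Fin n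
  1ₙ = fromℕ< (m%n<n 1 n)

module _ {n m : ℕ} {{_ : NonZero n}} {{_ : NonZero m}} where
  -- vertices of K_n □ K_m : ℤ_n × ℤ_m
  V : Set
  V = Fin n × Fin m

  _⊕_ : V → V → V
  (a , b) ⊕ (c , d) = (a +ₙ c , b +ₙ d)

  ⊖_ : V → V
  ⊖ (a , b) = (-ₙ a , -ₙ b)

  𝟘 : V
  𝟘 = (0ₙ , 0ₙ)

  snd : V → Fin m
  snd = proj₂

  IsStep : V → Set
  IsStep (a , b) = (a ≢ 0ₙ × b ≡ 0ₙ) ⊎ (a ≡ 0ₙ × b ≢ 0ₙ)

  -- the array [a_1,…,a_ℓ] is a sequence a : ℕ → V, of which only
  -- a 1, …, a ℓ are ever used (a 0 and a g for g > ℓ are irrelevant).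
  -- seg a i d = a_{i+1} + … + a_{i+d}
  seg : (ℕ → V) → ℕ → ℕ → V
  seg a i zero = 𝟘
  seg a i (suc d) = seg a i d ⊕ a (i N.+ suc d)

  vtx : V → (ℕ → V) → ℕ → V
  vtx v₀ a i = v₀ ⊕ seg a 0 i

  IsPath : V → (ℕ → V) → ℕ → Set
  IsPath v₀ a ℓ = ∀ i j → i N.≤ ℓ → j N.≤ ℓ → i ≢ j → vtx v₀ a i ≢ vtx v₀ a j

  gen : V → V
  gen (a , b) = (a +ₙ 1ₙ , b)

  genPow : ℕ → V → V
  genPow zero x = x
  genPow (suc k) x = gen (genPow k x)

  -- edges as (endpoint, endpoint); {x,y} and {x',y'} lie in the same
  -- G-orbit iff {c^k x, c^k y} = {x', y'} as unordered pairs for some k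
  SameOrbit : V × V → V × V → Set
  SameOrbit (x , y) (x' , y') =
    ∃ λ k → (genPow k x ≡ x' × genPow k y ≡ y') ⊎ (genPow k x ≡ y' × genPow k y ≡ x')

  -- the i-th edge {v_{i-1}, v_i} (for 1 ≤ i ≤ ℓ), given via i = suc i'
  edge : V → (ℕ → V) → ℕ → V × V
  edge v₀ a i' = (vtx v₀ a i' , vtx v₀ a (suc i'))

  AtMostOnePerOrbit : V → (ℕ → V) → ℕ → Set
  AtMostOnePerOrbit v₀ a ℓ =
    ∀ i j → i N.< j → j N.< ℓ → ¬' (SameOrbit (edge v₀ a i) (edge v₀ a j))
    where
      open import Relation.Nullary using () renaming (¬_ to ¬')

  CondA : (ℕ → V) → ℕ → ℕ → Set
  CondA a i j = snd (seg a i (j ∸ i)) ≢ 0ₙ ⊎ a (suc i) ≢ a (suc j)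

  CondB : (ℕ → V) → ℕ → ℕ → Set
  CondB a i j = snd (seg a i (suc j ∸ i)) ≢ 0ₙ ⊎ a (suc i) ≢ ⊖ a (suc j)

{-# OPTIONS --safe #-}
module Submission where

open import Defs
open import Data.Nat using (ℕ; zero; suc; _+_; _∸_; NonZero; _≤_; _<_)
open import Data.Nat.Properties using (+-comm; +-assoc; +-identityʳ; +-suc; +-∸-assoc; m+[n∸m]≡n; <⇒≤)
open import Data.Nat.DivMod using (_%_; m%n<n; %-distribˡ-+; n%n≡0; m*n%n≡0; m<n⇒m%n≡m)
open import Data.Fin using (Fin; toℕ; fromℕ<; _≟_)
open import Data.Fin.Properties using (toℕ-fromℕ<; toℕ-injective; toℕ<n)
open import Data.Product using (_×_; _,_; proj₁; proj₂; ∃-syntax)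
open import Data.Sum using (_⊎_; inj₁; inj₂; [_,_])
open import Function using (_∘_)
open import Function.Bundles using (_⇔_; mk⇔; Equivalence)
open import Relation.Nullary using (¬_; Dec; yes; no)
open import Relation.Binary.PropositionalEquality using (_≡_; refl; sym; trans; cong; cong₂; subst; subst₂; module ≡-Reasoning)
open import Relation.Binary.PropositionalEquality.Algebra using (isMagma)
open import Algebra.Bundles using (AbelianGroup)
import Algebra.Properties.AbelianGroup as AbelianGroupProperties
import Algebra.Properties.CommutativeSemigroup as CommutativeSemigroupProperties
open import Level using (0ℓ)
import Algebra.Structures as Structures
open import Algebra.Consequences.Propositional using (comm∧idʳ⇒id; comm∧invʳ⇒inv)
open ≡-Reasoning

-- The powers of c are exactly the translations by the vectors (t , 0).  Edges i and j of
-- the path are {u , u + a_{i+1}} and {u + s , u + s + a_{j+1}} with s = a_{i+1} + ⋯ + a_j.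
-- A translation by t maps the first edge onto the second either in order, which forces
-- t = s and a_{i+1} = a_{j+1}, or reversed, which forces t = s + a_{j+1} and
-- a_{i+1} = -a_{j+1}; so the two edges share an orbit exactly when (a) or (b) fails.

module _ {p q} {P : Set p} {Q : Set q} where

  ¬×⇒¬⊎¬ : Dec P → ¬ (P × Q) → ¬ P ⊎ ¬ Q
  ¬×⇒¬⊎¬ (yes p) ¬p×q = inj₂ (λ q → ¬p×q (p , q))
  ¬×⇒¬⊎¬ (no ¬p) _    = inj₁ ¬p

  ¬⊎¬⇒¬× : ¬ P ⊎ ¬ Q → ¬ (P × Q)
  ¬⊎¬⇒¬× = [ (λ ¬p → ¬p ∘ proj₁) , (λ ¬q → ¬q ∘ proj₂) ]

module ModularFin {n : ℕ} {{_ : NonZero n}} where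

  -- Defs gives x +ₙ y = [ toℕ x + toℕ y ]ₙ, 0ₙ = [ 0 ]ₙ and -ₙ x = [ n ∸ toℕ x ]ₙ definitionally.
  [_]ₙ : ℕ → Fin n
  [ k ]ₙ = fromℕ< (m%n<n k n)

  toℕ-[]ₙ : ∀ k → toℕ [ k ]ₙ ≡ k % n
  toℕ-[]ₙ k = toℕ-fromℕ< (m%n<n k n)

  []ₙ-toℕ : (x : Fin n) → [ toℕ x ]ₙ ≡ x
  []ₙ-toℕ x = toℕ-injective (trans (toℕ-[]ₙ (toℕ x)) (m<n⇒m%n≡m (toℕ<n x)))

  []ₙ-cong-% : ∀ {k l} → k % n ≡ l % n → [ k ]ₙ ≡ [ l ]ₙ
  []ₙ-cong-% {k} {l} eq = toℕ-injective (trans (toℕ-[]ₙ k) (trans eq (sym (toℕ-[]ₙ l))))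

  []ₙ-+ : ∀ k l → [ k ]ₙ +ₙ [ l ]ₙ ≡ [ k + l ]ₙ
  []ₙ-+ k l = []ₙ-cong-% (begin
    (toℕ [ k ]ₙ + toℕ [ l ]ₙ) % n ≡⟨ cong₂ (λ u v → (u + v) % n) (toℕ-[]ₙ k) (toℕ-[]ₙ l) ⟩
    (k % n + l % n) % n         ≡⟨ %-distribˡ-+ k l n ⟨
    (k + l) % n                 ∎)

  +ₙ-comm : (x y : Fin n) → x +ₙ y ≡ y +ₙ x
  +ₙ-comm x y = cong [_]ₙ (+-comm (toℕ x) (toℕ y))

  +ₙ-assoc : (x y z : Fin n) → (x +ₙ y) +ₙ z ≡ x +ₙ (y +ₙ z)
  +ₙ-assoc x y z = begin
    (x +ₙ y) +ₙ z                       ≡⟨ cong ((x +ₙ y) +ₙ_) ([]ₙ-toℕ z) ⟨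
    [ toℕ x + toℕ y ]ₙ +ₙ [ toℕ z ]ₙ      ≡⟨ []ₙ-+ (toℕ x + toℕ y) (toℕ z) ⟩
    [ toℕ x + toℕ y + toℕ z ]ₙ           ≡⟨ cong [_]ₙ (+-assoc (toℕ x) (toℕ y) (toℕ z)) ⟩
    [ toℕ x + (toℕ y + toℕ z) ]ₙ         ≡⟨ []ₙ-+ (toℕ x) (toℕ y + toℕ z) ⟨
    [ toℕ x ]ₙ +ₙ [ toℕ y + toℕ z ]ₙ      ≡⟨ cong (_+ₙ (y +ₙ z)) ([]ₙ-toℕ x) ⟩
    x +ₙ (y +ₙ z)                       ∎

  +ₙ-identityʳ : (x : Fin n) → x +ₙ 0ₙ ≡ x
  +ₙ-identityʳ x = begin
    x +ₙ 0ₙ           ≡⟨ cong (_+ₙ 0ₙ) ([]ₙ-toℕ x) ⟨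
    [ toℕ x ]ₙ +ₙ [ 0 ]ₙ ≡⟨ []ₙ-+ (toℕ x) 0 ⟩
    [ toℕ x + 0 ]ₙ      ≡⟨ cong [_]ₙ (+-comm (toℕ x) 0) ⟩
    [ toℕ x ]ₙ          ≡⟨ []ₙ-toℕ x ⟩
    x                  ∎

  +ₙ-inverseʳ : (x : Fin n) → x +ₙ (-ₙ x) ≡ 0ₙ
  +ₙ-inverseʳ x = begin
    x +ₙ (-ₙ x)                  ≡⟨ cong (_+ₙ (-ₙ x)) ([]ₙ-toℕ x) ⟨
    [ toℕ x ]ₙ +ₙ [ n ∸ toℕ x ]ₙ   ≡⟨ []ₙ-+ (toℕ x) (n ∸ toℕ x) ⟩
    [ toℕ x + (n ∸ toℕ x) ]ₙ      ≡⟨ cong [_]ₙ (m+[n∸m]≡n (<⇒≤ (toℕ<n x))) ⟩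
    [ n ]ₙ                        ≡⟨ []ₙ-cong-% (trans (n%n≡0 n) (sym (m*n%n≡0 0 n))) ⟩
    [ 0 ]ₙ                        ∎

module _ {n m : ℕ} {{_ : NonZero n}} {{_ : NonZero m}} where
  open ModularFin

  private
    Vertex : Set
    Vertex = V {n} {m}

  ⊕-isAbelianGroup : Structures.IsAbelianGroup _≡_ (_⊕_ {n} {m}) 𝟘 ⊖_
  ⊕-isAbelianGroup = record
    { isGroup = record
      { isMonoid = record
        { isSemigroup = record { isMagma = isMagma _⊕_ ; assoc = ⊕-assoc }
        ; identity = comm∧idʳ⇒id ⊕-comm ⊕-identityʳ
        }
      ; inverse = comm∧invʳ⇒inv ⊕-comm ⊕-inverseʳ
      ; ⁻¹-cong = cong ⊖_
      }
    ; comm = ⊕-comm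
    }
    where
    ⊕-comm : (x y : Vertex) → x ⊕ y ≡ y ⊕ x
    ⊕-comm (a , b) (c , d) = cong₂ _,_ (+ₙ-comm a c) (+ₙ-comm b d)
    ⊕-assoc : (x y z : Vertex) → (x ⊕ y) ⊕ z ≡ x ⊕ (y ⊕ z)
    ⊕-assoc (a , b) (c , d) (e , f) = cong₂ _,_ (+ₙ-assoc a c e) (+ₙ-assoc b d f)
    ⊕-identityʳ : (x : Vertex) → x ⊕ 𝟘 ≡ x
    ⊕-identityʳ (a , b) = cong₂ _,_ (+ₙ-identityʳ a) (+ₙ-identityʳ b)
    ⊕-inverseʳ : (x : Vertex) → x ⊕ (⊖ x) ≡ 𝟘
    ⊕-inverseʳ (a , b) = cong₂ _,_ (+ₙ-inverseʳ a) (+ₙ-inverseʳ b)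

  ⊕-abelianGroup : AbelianGroup 0ℓ 0ℓ
  ⊕-abelianGroup = record { isAbelianGroup = ⊕-isAbelianGroup }

  open AbelianGroup ⊕-abelianGroup using (assoc; identityʳ; inverseʳ; commutativeSemigroup)
  open AbelianGroupProperties ⊕-abelianGroup using (∙-cancelˡ; inverseʳ-unique)
  open CommutativeSemigroupProperties commutativeSemigroup using (xy∙z≈xz∙y)

  snd-genPow : ∀ k (x : Vertex) → snd (genPow k x) ≡ snd x
  snd-genPow zero x = refl
  snd-genPow (suc k) x = snd-genPow k x

  genPow-⊕ : ∀ k (x y : Vertex) → genPow k (x ⊕ y) ≡ x ⊕ genPow k y
  genPow-⊕ zero x y = refl
  genPow-⊕ (suc k) x y = trans (cong gen (genPow-⊕ k x y)) (gen-⊕ x (genPow k y))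
    where
    gen-⊕ : (x y : Vertex) → gen (x ⊕ y) ≡ x ⊕ gen y
    gen-⊕ (a , b) (c , d) = cong (_, b +ₙ d) (+ₙ-assoc a c 1ₙ)

  genPow-translate : ∀ k (x : Vertex) → genPow k x ≡ x ⊕ genPow k 𝟘
  genPow-translate k x = trans (cong (genPow k) (sym (identityʳ x))) (genPow-⊕ k x 𝟘)

  genPow-𝟘 : ∀ k → genPow k (𝟘 {n} {m}) ≡ ([ k ]ₙ , 0ₙ)
  genPow-𝟘 zero = refl
  genPow-𝟘 (suc k) = begin
    gen (genPow k 𝟘)      ≡⟨ cong gen (genPow-𝟘 k) ⟩
    ([ k ]ₙ +ₙ [ 1 ]ₙ , 0ₙ) ≡⟨ cong (_, 0ₙ) ([]ₙ-+ k 1) ⟩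
    ([ k + 1 ]ₙ , 0ₙ)      ≡⟨ cong (λ l → [ l ]ₙ , 0ₙ) (+-comm k 1) ⟩
    ([ suc k ]ₙ , 0ₙ)      ∎

  genPow-𝟘-horizontal : ∀ {t : Vertex} → snd t ≡ 0ₙ → genPow (toℕ (proj₁ t)) 𝟘 ≡ t
  genPow-𝟘-horizontal h = trans (genPow-𝟘 _) (cong₂ _,_ ([]ₙ-toℕ _) (sym h))

  MapsEdge : (Vertex → Vertex) → Vertex × Vertex → Vertex × Vertex → Set
  MapsEdge f (x , y) (x' , y') = (f x ≡ x' × f y ≡ y') ⊎ (f x ≡ y' × f y ≡ x')

  mapsEdge-cong : ∀ {f g e e'} → (∀ z → f z ≡ g z) → MapsEdge f e e' → MapsEdge g e e'
  mapsEdge-cong {e = x , y} f≗g (inj₁ (p , q)) = inj₁ (trans (sym (f≗g x)) p , trans (sym (f≗g y)) q)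
  mapsEdge-cong {e = x , y} f≗g (inj₂ (p , q)) = inj₂ (trans (sym (f≗g x)) p , trans (sym (f≗g y)) q)

  sameOrbit⇔horizontalTranslate : ∀ e e' →
    SameOrbit e e' ⇔ (∃[ t ] snd t ≡ 0ₙ × MapsEdge (_⊕ t) e e')
  sameOrbit⇔horizontalTranslate _ _ = mk⇔
    (λ (k , p) → genPow k 𝟘 , snd-genPow k 𝟘 , mapsEdge-cong (genPow-translate k) p)
    (λ (t , h , p) → toℕ (proj₁ t) , mapsEdge-cong (λ z → sym (translate h z)) p)
    where
    translate : ∀ {t} → snd t ≡ 0ₙ → ∀ z → genPow (toℕ (proj₁ t)) z ≡ z ⊕ t
    translate h z = trans (genPow-translate _ z) (cong (z ⊕_) (genPow-𝟘-horizontal h))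

  translate-parallel : ∀ {x t w α β : Vertex} → x ⊕ t ≡ w → ((x ⊕ α) ⊕ t ≡ w ⊕ β) ⇔ (α ≡ β)
  translate-parallel {x} {t} {w} {α} {β} x⊕t≡w =
    mk⇔ (∙-cancelˡ w α β ∘ trans (sym moved)) (trans moved ∘ cong (w ⊕_))
    where
    moved : (x ⊕ α) ⊕ t ≡ w ⊕ α
    moved = trans (xy∙z≈xz∙y x α t) (cong (_⊕ α) x⊕t≡w)

  translate-antiparallel : ∀ {x t w α β : Vertex} → x ⊕ t ≡ w ⊕ β → ((x ⊕ α) ⊕ t ≡ w) ⇔ (α ≡ ⊖ β)
  translate-antiparallel {x} {t} {w} {α} {β} x⊕t≡w⊕β = mk⇔
    (λ eq → inverseʳ-unique β α (∙-cancelˡ w _ _ (trans (sym moved) (trans eq (sym (identityʳ w))))))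
    (λ α≡⊖β → begin
      (x ⊕ α) ⊕ t    ≡⟨ moved ⟩
      w ⊕ (β ⊕ α)    ≡⟨ cong (λ z → w ⊕ (β ⊕ z)) α≡⊖β ⟩
      w ⊕ (β ⊕ (⊖ β)) ≡⟨ cong (w ⊕_) (inverseʳ β) ⟩
      w ⊕ 𝟘          ≡⟨ identityʳ w ⟩
      w              ∎)
    where
    moved : (x ⊕ α) ⊕ t ≡ w ⊕ (β ⊕ α)
    moved = trans (xy∙z≈xz∙y x α t) (trans (cong (_⊕ α) x⊕t≡w⊕β) (assoc w β α))

  sameOrbit-segments⇔ : (u s α β : Vertex) →
    SameOrbit (u , u ⊕ α) (u ⊕ s , (u ⊕ s) ⊕ β) ⇔
    ((snd s ≡ 0ₙ × α ≡ β) ⊎ (snd (s ⊕ β) ≡ 0ₙ × α ≡ ⊖ β))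
  sameOrbit-segments⇔ u s α β = mk⇔ (to ∘ Equivalence.to (sameOrbit⇔horizontalTranslate e e')) from
    where
    e e' : Vertex × Vertex
    e = u , u ⊕ α
    e' = u ⊕ s , (u ⊕ s) ⊕ β
    to : ∃[ t ] snd t ≡ 0ₙ × MapsEdge (_⊕ t) e e' →
         (snd s ≡ 0ₙ × α ≡ β) ⊎ (snd (s ⊕ β) ≡ 0ₙ × α ≡ ⊖ β)
    to (t , h , inj₁ (p , q)) =
      inj₁ (subst (λ z → snd z ≡ 0ₙ) (∙-cancelˡ u t s p) h , Equivalence.to (translate-parallel p) q)
    to (t , h , inj₂ (p , q)) =
      inj₂ (subst (λ z → snd z ≡ 0ₙ) (∙-cancelˡ u t (s ⊕ β) (trans p (assoc u s β))) h
           , Equivalence.to (translate-antiparallel p) q)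
    from : (snd s ≡ 0ₙ × α ≡ β) ⊎ (snd (s ⊕ β) ≡ 0ₙ × α ≡ ⊖ β) → SameOrbit e e'
    from (inj₁ (h , α≡β)) = Equivalence.from (sameOrbit⇔horizontalTranslate e e')
      (s , h , inj₁ (refl , Equivalence.from (translate-parallel refl) α≡β))
    from (inj₂ (h , α≡⊖β)) = Equivalence.from (sameOrbit⇔horizontalTranslate e e')
      (s ⊕ β , h , inj₂ (sym (assoc u s β) , Equivalence.from (translate-antiparallel (sym (assoc u s β))) α≡⊖β))

  seg-+ : (a : ℕ → Vertex) → ∀ k i d → seg a k (i + d) ≡ seg a k i ⊕ seg a (k + i) d
  seg-+ a k i zero = trans (cong (seg a k) (+-identityʳ i)) (sym (identityʳ _))
  seg-+ a k i (suc d) = begin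
    seg a k (i + suc d)                             ≡⟨ cong (seg a k) (+-suc i d) ⟩
    seg a k (i + d) ⊕ a (k + suc (i + d))           ≡⟨ cong₂ _⊕_ (seg-+ a k i d) (cong a index) ⟩
    (seg a k i ⊕ seg a (k + i) d) ⊕ a (k + i + suc d) ≡⟨ assoc _ _ _ ⟩
    seg a k i ⊕ seg a (k + i) (suc d)               ∎
    where
    index : k + suc (i + d) ≡ k + i + suc d
    index = trans (cong (k +_) (sym (+-suc i d))) (sym (+-assoc k i (suc d)))

  vtx-∸ : ∀ (v₀ : Vertex) a {i j} → i ≤ j → vtx v₀ a j ≡ vtx v₀ a i ⊕ seg a i (j ∸ i)
  vtx-∸ v₀ a {i} {j} i≤j = begin
    v₀ ⊕ seg a 0 j                      ≡⟨ cong (λ l → v₀ ⊕ seg a 0 l) (m+[n∸m]≡n i≤j) ⟨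
    v₀ ⊕ seg a 0 (i + (j ∸ i))          ≡⟨ cong (v₀ ⊕_) (seg-+ a 0 i (j ∸ i)) ⟩
    v₀ ⊕ (seg a 0 i ⊕ seg a i (j ∸ i))  ≡⟨ assoc _ _ _ ⟨
    (v₀ ⊕ seg a 0 i) ⊕ seg a i (j ∸ i)  ∎

  seg-suc-∸ : ∀ (a : ℕ → Vertex) {i j} → i ≤ j → seg a i (suc j ∸ i) ≡ seg a i (j ∸ i) ⊕ a (suc j)
  seg-suc-∸ a {i} {j} i≤j = begin
    seg a i (suc j ∸ i)                    ≡⟨ cong (seg a i) (+-∸-assoc 1 i≤j) ⟩
    seg a i (j ∸ i) ⊕ a (i + suc (j ∸ i))  ≡⟨ cong (λ l → seg a i (j ∸ i) ⊕ a l) index ⟩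
    seg a i (j ∸ i) ⊕ a (suc j)            ∎
    where
    index : i + suc (j ∸ i) ≡ suc j
    index = trans (+-suc i (j ∸ i)) (cong suc (m+[n∸m]≡n i≤j))

  edge≡step : ∀ (v₀ : Vertex) a i → edge v₀ a i ≡ (vtx v₀ a i , vtx v₀ a i ⊕ a (suc i))
  edge≡step v₀ a i = cong (vtx v₀ a i ,_) (sym (assoc v₀ (seg a 0 i) (a (suc i))))

  sameOrbit-edges⇔ : ∀ (v₀ : Vertex) a {i j} → i ≤ j →
    SameOrbit (edge v₀ a i) (edge v₀ a j) ⇔
    ((snd (seg a i (j ∸ i)) ≡ 0ₙ × a (suc i) ≡ a (suc j)) ⊎
     (snd (seg a i (suc j ∸ i)) ≡ 0ₙ × a (suc i) ≡ ⊖ a (suc j)))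
  sameOrbit-edges⇔ v₀ a {i} {j} i≤j =
    subst₂ (λ e e' → SameOrbit e e' ⇔ conditions (seg a i (suc j ∸ i))) (sym (edge≡step v₀ a i)) (sym edge-j)
      (subst (λ t → SameOrbit (u , u ⊕ α) (u ⊕ s , (u ⊕ s) ⊕ β) ⇔ conditions t) (sym (seg-suc-∸ a i≤j))
        (sameOrbit-segments⇔ u s α β))
    where
    u = vtx v₀ a i
    s = seg a i (j ∸ i)
    α = a (suc i)
    β = a (suc j)
    conditions : Vertex → Set
    conditions t = (snd s ≡ 0ₙ × α ≡ β) ⊎ (snd t ≡ 0ₙ × α ≡ ⊖ β)
    edge-j : edge v₀ a j ≡ (u ⊕ s , (u ⊕ s) ⊕ β)
    edge-j = trans (edge≡step v₀ a j) (cong (λ w → w , w ⊕ β) (vtx-∸ v₀ a i≤j))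

  differentOrbits⇔condA×condB : ∀ (v₀ : Vertex) a {i j} → i ≤ j →
    (¬ SameOrbit (edge v₀ a i) (edge v₀ a j)) ⇔ (CondA a i j × CondB a i j)
  differentOrbits⇔condA×condB v₀ a i≤j = mk⇔
    (λ ¬o → ¬×⇒¬⊎¬ (_ ≟ _) (¬o ∘ from ∘ inj₁) , ¬×⇒¬⊎¬ (_ ≟ _) (¬o ∘ from ∘ inj₂))
    (λ (condA , condB) → [ ¬⊎¬⇒¬× condA , ¬⊎¬⇒¬× condB ] ∘ to)
    where open Equivalence (sameOrbit-edges⇔ v₀ a i≤j)

lemma10 : (n m : ℕ) → {{_ : NonZero n}} → {{_ : NonZero m}} →
    (ℓ : ℕ) (v₀ : V {n} {m}) (a : ℕ → V {n} {m}) →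
    (∀ g → 1 ≤ g → g ≤ ℓ → IsStep (a g)) →
    IsPath v₀ a ℓ →
    AtMostOnePerOrbit v₀ a ℓ ⇔ (∀ i j → i < j → j < ℓ → CondA a i j × CondB a i j)
lemma10 n m ℓ v₀ a _ _ = mk⇔
  (λ H i j i<j j<ℓ → to (differentOrbits⇔condA×condB v₀ a (<⇒≤ i<j)) (H i j i<j j<ℓ))
  (λ H i j i<j j<ℓ → from (differentOrbits⇔condA×condB v₀ a (<⇒≤ i<j)) (H i j i<j j<ℓ))
  where open Equivalence
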